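{- Let $X_1,\dots,X_{n+1}$ be sets with metrics $d_1,\dots,d_n$ on $X_1,\dots,X_n$, let $f_i:X_i\to X_{i+1}$ for $i=1,\dots,n$, and for each $i$ let $\delta_i$ be a map from $X_{i+1}$ to a set of discrete decisions. Suppose each layer $L_i=(f_i,\delta_i)$ is certified with gain $g_i\in\mathbb{Q}_{\ge 0}$ and margin $m_i\in\mathbb{Q}_{\ge 0}$, meaning: for all $x,x'\in X_i$ with $d_i(x,x')<m_i$, (a) if $i<n$ then $d_{i+1}(f_i(x),f_i(x'))\le g_i\,d_i(x,x')$, and (b) $\delta_i(f_i(x))=\delta_i(f_i(x'))$. Let $\varepsilon_0>0$ and define $\varepsilon^\star_1=\varepsilon_0$, $\varepsilon^\star_{i+1}=g_i\,\varepsilon^\star_i$. If $\varepsilon^\star_i<m_i$ for every $i=1,\dots,n$, then for all $x_0,x'\in X_1$ with $d_1(x_0,x')<\varepsilon_0$, the pipeline $\Pi=f_n\circ\cdots\circ f_1$ satisfies $\delta_n(\Pi(x'))=\delta_n(\Pi(x_0))$.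
   Context: A "certified layer" is a pipeline stage whose certificate witnesses a local Lipschitz bound (gain) valid within a radius (margin) together with invariance of the layer's discrete decision (or canonicalized output) for inputs within that margin. The conclusion is stated at the level of the final layer's discrete decision / canonical denotation.
   Formalization: The metrics $d_1,\dots,d_n$ take values in ℚ, and $\varepsilon_0$ is rational. -}

module Defs where

open import Data.Nat using (ℕ; zero; suc)
import Data.Nat as ℕ
open import Data.Rational using (ℚ; 0ℚ; _+_; _*_; _≤_; _<_)
open import Data.Product using (_×_)
open import Relation.Binary.PropositionalEquality using (_≡_)
open import Function.Bundles using (_⇔_)

record IsMetric {A : Set} (d : A → A → ℚ) : Set where
  field
    nonneg    : ∀ x y → 0ℚ ≤ d x y
    zero⇔eq   : ∀ x y → (d x y ≡ 0ℚ) ⇔ (x ≡ y)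
    symmetric : ∀ x y → d x y ≡ d y x
    triangle  : ∀ x y z → d x z ≤ d x y + d y z

-- Pipeline data (indices 1..n are meaningful; index 0 is junk):
--   X i      : the i-th space (i = 1 .. n+1)
--   d i      : metric on X i   (i = 1 .. n)
--   f i      : X i → X (i+1)   (i = 1 .. n)
--   D i      : decision set of layer i
--   δ i      : X (i+1) → D i   (i = 1 .. n)

Certified : (n : ℕ) (X : ℕ → Set) (d : (i : ℕ) → X i → X i → ℚ)
            (f : (i : ℕ) → X i → X (suc i))
            (D : ℕ → Set) (δ : (i : ℕ) → X (suc i) → D i)
            (i : ℕ) (g m : ℚ) → Set
Certified n X d f D δ i g m =
  (0ℚ ≤ g) × (0ℚ ≤ m) ×
  (∀ (x x′ : X i) → d i x x′ < m →
     (i ℕ.< n → d (suc i) (f i x) (f i x′) ≤ g * d i x x′)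
     × δ i (f i x) ≡ δ i (f i x′))

εstar : (ε₀ : ℚ) (g : ℕ → ℚ) → ℕ → ℚ
εstar ε₀ g zero = ε₀
εstar ε₀ g (suc zero) = ε₀
εstar ε₀ g (suc (suc i)) = g (suc i) * εstar ε₀ g (suc i)

-- run k = f k ∘ ⋯ ∘ f 1 : X 1 → X (k+1);  the pipeline Π is run n.
run : (X : ℕ → Set) (f : (i : ℕ) → X i → X (suc i)) (k : ℕ) → X 1 → X (suc k)
run X f zero x = x
run X f (suc k) x = f (suc k) (run X f k x)

-- Running the pipeline layer by layer, the distance between the two images after
-- layer j is at most ε⋆ (j+1): it starts below ε₀, and each layer, applied to
-- points closer than ε⋆ j < m j, multiplies the distance by at most g j. Hence
-- the two inputs of the last layer are within its margin, and its certificate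
-- makes the final decisions agree.
module Submission where

open import Defs
open import Data.Nat using (ℕ; suc; s≤s; z≤n)
import Data.Nat as ℕ
import Data.Nat.Properties as ℕ
open import Data.Rational using (ℚ; 0ℚ; _<_; _≤_; _*_; nonNegative)
open import Data.Rational.Properties using (≤-trans; <⇒≤; ≤-<-trans; *-monoˡ-≤-nonNeg)
open import Data.Product using (_,_; proj₁; proj₂)
open import Relation.Binary.PropositionalEquality using (_≡_; sym)

module _ (n : ℕ) (X : ℕ → Set) (d : (i : ℕ) → X i → X i → ℚ)
         (f : (i : ℕ) → X i → X (suc i))
         (D : ℕ → Set) (δ : (i : ℕ) → X (suc i) → D i)
         (g m : ℕ → ℚ)
         (cert : ∀ i → 1 ℕ.≤ i → i ℕ.≤ n → Certified n X d f D δ i (g i) (m i))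
         (ε₀ : ℚ)
         (εstar<margin : ∀ i → 1 ℕ.≤ i → i ℕ.≤ n → εstar ε₀ g i < m i)
         (x₀ x′ : X 1) (d₁< : d 1 x₀ x′ < ε₀)
  where

  dist-run-≤-εstar : ∀ j → j ℕ.< n →
    d (suc j) (run X f j x₀) (run X f j x′) ≤ εstar ε₀ g (suc j)
  dist-run-≤-εstar ℕ.zero _ = <⇒≤ d₁<
  dist-run-≤-εstar (suc j) j+1<n =
    ≤-trans lipschitz (*-monoˡ-≤-nonNeg (g (suc j)) ih)
    where
    j+1≤n : suc j ℕ.≤ n
    j+1≤n = ℕ.<⇒≤ j+1<n
    certⱼ₊₁ : Certified n X d f D δ (suc j) (g (suc j)) (m (suc j))
    certⱼ₊₁ = cert (suc j) (s≤s z≤n) j+1≤n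
    instance _ = nonNegative (proj₁ certⱼ₊₁)
    ih : d (suc j) (run X f j x₀) (run X f j x′) ≤ εstar ε₀ g (suc j)
    ih = dist-run-≤-εstar j j+1≤n
    lipschitz : d (suc (suc j)) (run X f (suc j) x₀) (run X f (suc j) x′)
                  ≤ g (suc j) * d (suc j) (run X f j x₀) (run X f j x′)
    lipschitz = proj₁ (proj₂ (proj₂ certⱼ₊₁) _ _
                  (≤-<-trans ih (εstar<margin (suc j) (s≤s z≤n) j+1≤n))) j+1<n

  dist-run-<-margin : ∀ k → suc k ℕ.≤ n →
    d (suc k) (run X f k x₀) (run X f k x′) < m (suc k)
  dist-run-<-margin k k<n =
    ≤-<-trans (dist-run-≤-εstar k k<n) (εstar<margin (suc k) (s≤s z≤n) k<n)

mainTheorem6 : (n : ℕ) → 1 ℕ.≤ n →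
    (X : ℕ → Set) (d : (i : ℕ) → X i → X i → ℚ) →
    (∀ i → 1 ℕ.≤ i → i ℕ.≤ n → IsMetric (d i)) →
    (f : (i : ℕ) → X i → X (suc i)) →
    (D : ℕ → Set) (δ : (i : ℕ) → X (suc i) → D i) →
    (g m : ℕ → ℚ) →
    (∀ i → 1 ℕ.≤ i → i ℕ.≤ n → Certified n X d f D δ i (g i) (m i)) →
    (ε₀ : ℚ) → 0ℚ < ε₀ →
    (∀ i → 1 ℕ.≤ i → i ℕ.≤ n → εstar ε₀ g i < m i) →
    ∀ (x₀ x′ : X 1) → d 1 x₀ x′ < ε₀ →
    δ n (run X f n x′) ≡ δ n (run X f n x₀)
mainTheorem6 (suc k) _ X d _ f D δ g m cert ε₀ _ εstar<margin x₀ x′ d₁< =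
  sym (proj₂ (proj₂ (proj₂ lastCert) _ _ inputs-within-margin))
  where
  lastCert : Certified (suc k) X d f D δ (suc k) (g (suc k)) (m (suc k))
  lastCert = cert (suc k) (s≤s z≤n) ℕ.≤-refl
  inputs-within-margin : d (suc k) (run X f k x₀) (run X f k x′) < m (suc k)
  inputs-within-margin =
    dist-run-<-margin (suc k) X d f D δ g m cert ε₀ εstar<margin x₀ x′ d₁< k ℕ.≤-refl
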